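{- Let $G$ be a finite group and let $\Sigma=\mathrm{Cay}(G,(T_{i,j})_{3\times 3})$ be a $3$-PGSR of $G$ such that, for some integer $k$ with $2\leq k\leq |G|$: (a) the vertex $(g,1)$ has valency $k+1$ for each $g\in G$; (b) the vertices $(g,2)$ and $(g,3)$ have valency $k$ for each $g\in G$; (c) for each $g\in G$ and $i\in\{1,2,3\}$ there is a $3$-cycle of $\Sigma$ through $(g,i)$. Then $G$ has an $m$-HGR for each odd integer $m\geq 5$.
   Context: For a finite group $G$ and integer $m\geq1$, let $(T_{i,j})_{m\times m}$ be a matrix of subsets of $G$ with $1\notin T_{i,i}$ and $T_{j,i}=T_{i,j}^{ -1}=\{t^{ -1}:t\in T_{i,j}\}$ for all $i,j$. The $m$-Cayley graph $\mathrm{Cay}(G,(T_{i,j})_{m\times m})$ has vertex set $G\times\{1,\dots,m\}$ (write $g_i=(g,i)$, $G_i=G\times\{i\}$) and edges $\{g_i,(tg)_j\}$ for all $i,j$, $g\in G$, $t\in T_{i,j}$. Right multiplication $x_i\mapsto (xg)_i$ gives a semiregular group of automorphisms isomorphic to $G$ with orbits $G_1,\dots,G_m$. An $m$-PGSR ($m$-partite graphical semiregular representation) of $G$ is such an $m$-Cayley graph with $T_{1,1}=\dots=T_{m,m}=\emptyset$ (not necessarily regular) whose full automorphism group is isomorphic to $G$. For $m\geq2$, an $m$-HGR of $G$ is a regular $m$-partite graph whose automorphism group is isomorphic to $G$ and acts semiregularly on vertices with orbits the parts of the $m$-partition (each part independent); equivalently, a regular $m$-Cayley graph of $G$ with all $T_{i,i}=\emptyset$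 whose automorphism group is isomorphic to $G$. -}

module Defs where

open import Level using (0ℓ)
open import Data.Bool using (Bool; true; false)
open import Data.Nat using (ℕ; suc; _≤_)
open import Data.Nat.Divisibility using (_∣_)
open import Data.Fin using (Fin)
open import Data.List using (List; length; filterᵇ; cartesianProduct; map; allFin)
open import Data.Product using (_×_; _,_; Σ; ∃; ∃-syntax)
open import Relation.Binary.PropositionalEquality using (_≡_; _≢_)
open import Relation.Nullary using (¬_)
open import Algebra.Structures using (IsGroup)
open import Function.Bundles using (_↔_; Inverse)

record FiniteGroup : Set₁ where
  infixl 7 _∙_
  field
    Carrier : Set
    _∙_     : Carrier → Carrier → Carrier
    ε       : Carrier
    _⁻¹     : Carrier → Carrier
    isGroup : IsGroup _≡_ _∙_ ε _⁻¹
    order   : ℕ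
    enum    : Carrier ↔ Fin order

  elements : List Carrier
  elements = map (Inverse.from enum) (allFin order)

module _ (G : FiniteGroup) where
  open FiniteGroup G

  -- A matrix (T_{i,j})_{m×m} of subsets of G (decidable membership).
  Subsets : ℕ → Set
  Subsets m = Fin m → Fin m → Carrier → Bool

  Vertex : ℕ → Set
  Vertex m = Carrier × Fin m

  vertices : (m : ℕ) → List (Vertex m)
  vertices m = cartesianProduct elements (allFin m)

  record Admissible {m : ℕ} (T : Subsets m) : Set where
    field
      diag-empty : ∀ i t → T i i t ≡ false
      inv-sym    : ∀ i j t → T j i t ≡ T i j (t ⁻¹)

  -- Adjacency in Cay(G,(T_{i,j})): g_i ~ h_j  iff  h = t g for some t ∈ T_{i,j},
  -- i.e. iff h g⁻¹ ∈ T_{i,j}.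
  Adj : {m : ℕ} → Subsets m → Vertex m → Vertex m → Bool
  Adj T (g , i) (h , j) = T i j (h ∙ g ⁻¹)

  valency : {m : ℕ} → Subsets m → Vertex m → ℕ
  valency {m} T v = length (filterᵇ (Adj T v) (vertices m))

  Regular : {m : ℕ} → Subsets m → Set
  Regular {m} T = ∃[ d ] (∀ (v : Vertex m) → valency T v ≡ d)

  HasTriangleThrough : {m : ℕ} → Subsets m → Vertex m → Set
  HasTriangleThrough {m} T v =
    ∃[ u ] ∃[ w ] (v ≢ u × u ≢ w × w ≢ v ×
      Adj T v u ≡ true × Adj T u w ≡ true × Adj T w v ≡ true)

  IsAutomorphism : {m : ℕ} → Subsets m → (Vertex m ↔ Vertex m) → Set
  IsAutomorphism T σ =
    ∀ v w → Adj T (Inverse.to σ v) (Inverse.to σ w) ≡ Adj T v w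

  rightMul : {m : ℕ} → Carrier → Vertex m → Vertex m
  rightMul g (x , i) = (x ∙ g , i)

  -- Aut(Cay(G,T)) ≅ G, i.e. the full automorphism group is the
  -- semiregular group R(G) of right multiplications.
  AutIsRG : {m : ℕ} → Subsets m → Set
  AutIsRG T = ∀ σ → IsAutomorphism T σ →
    ∃[ g ] (∀ v → Inverse.to σ v ≡ rightMul g v)

  IsPGSR : (m : ℕ) → Subsets m → Set
  IsPGSR m T = Admissible T × AutIsRG T

  HasHGR : ℕ → Set
  HasHGR m = 2 ≤ m × Σ (Subsets m) (λ T → Admissible T × Regular T × AutIsRG T)

Odd : ℕ → Set
Odd m = ¬ (2 ∣ m)

{-# OPTIONS --safe #-}
-- Write m = 3 + 2s.  Attach to Σ two paths ("rails") of s new parts each, hanging off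
-- the two parts of valency k by perfect matchings, with consecutive parts of a rail joined
-- by perfect matchings and the i-th parts of the two rails joined by a set C i whose size
-- brings every valency to k + 1.  Rail vertices lie on no triangle (rail edges flip a
-- 2-colouring, and a rail part meets at most one part of Σ) while every vertex of Σ does,
-- so an automorphism preserves Σ and, as Aut Σ = G, acts on it as right multiplication by
-- some g.  Walking outwards along the rails, each new part is the only neighbour part of a
-- pinned part not yet known to be pinned, and is matched to it, so the automorphism is
-- right multiplication by g everywhere.

module Submission where

open import Algebra.Bundles using (Group)
open import Algebra.Structures using (IsGroup)
import Algebra.Properties.Group as GroupProperties
open import Data.Bool using (Bool; true; false; not; _∧_; _∨_; T)
open import Data.Bool.Properties using (∨-comm; not-involutive; not-¬)
open import Data.Empty using (⊥; ⊥-elim)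
open import Data.Fin using (Fin; zero; suc; toℕ; inject₁; _↑ˡ_; _↑ʳ_; splitAt)
open import Data.Fin.Induction using (<-weakInduction)
import Data.Fin.Properties as Fin
open import Data.List using (_++_; length; filterᵇ; map; tabulate; cartesianProduct; allFin)
open import Data.List.Properties using (length-++; filter-++; map-tabulate)
open import Data.Nat using (ℕ; zero; suc; _+_; _*_; _∸_; _≤_; _≡ᵇ_; _<ᵇ_; z≤n; s≤s; s≤s⁻¹)
open import Data.Nat.Divisibility using (_∣0; ∣-refl; ∣m∣n⇒∣m+n)
open import Data.Nat.Properties using (+-0-commutativeMonoid; +-identityʳ; *-identityʳ; <⇒<ᵇ; 1+n≢n)
import Data.Nat.Properties as ℕ
open import Data.Nat.Solver using (module +-*-Solver)
open import Data.Product using (_×_; _,_; proj₁; proj₂; ∃-syntax)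
open import Data.Sum using (_⊎_; inj₁; inj₂; [_,_]′)
open import Function using (_∘_; _↔_; Inverse; Injection; mk↔ₛ′; mk⇔)
open import Function.Construct.Composition using (_↔-∘_)
open import Function.Construct.Symmetry using (↔-sym)
open import Function.Properties.Inverse using (↔⇒↣)
open import Relation.Binary.Definitions using (DecidableEquality)
open import Relation.Binary.PropositionalEquality
open import Relation.Nullary.Decidable using (Dec; yes; does; via-injection; does-⇔; dec-true; dec-false)
open import Relation.Nullary.Negation using (contradiction)

open import Algebra.Properties.CommutativeMonoid.Sum +-0-commutativeMonoid
open +-*-Solver using (solve; _:+_; _:=_)

open import Defs

iverson : Bool → ℕ
iverson true  = 1
iverson false = 0

∑-split : ∀ {a b} (f : Fin (a + b) → ℕ) →
          ∑[ i < a + b ] f i ≡ ∑[ i < a ] f (i ↑ˡ b) + ∑[ i < b ] f (a ↑ʳ i)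
∑-split {zero}  f = refl
∑-split {suc a} {b} f = trans (cong (f zero +_) (∑-split {a} {b} (f ∘ suc))) (sym (ℕ.+-assoc (f zero) _ _))

∑-select : ∀ {n} (i : Fin n) (f : Fin n → ℕ) → ∑[ j < n ] (iverson (does (j Fin.≟ i)) * f j) ≡ f i
∑-select {suc n} zero    f = trans (cong₂ _+_ (+-identityʳ (f zero)) (sum-replicate-zero n)) (+-identityʳ (f zero))
∑-select {suc n} (suc i) f = ∑-select i (f ∘ suc)

∑-iverson-≡ᵇ : ∀ {n} c → ∑[ j < n ] iverson (toℕ j ≡ᵇ c) ≡ iverson (c <ᵇ n)
∑-iverson-≡ᵇ {zero}  c       = refl
∑-iverson-≡ᵇ {suc n} zero    = cong suc (sum-replicate-zero n)
∑-iverson-≡ᵇ {suc n} (suc c) = ∑-iverson-≡ᵇ {n} c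

∑-iverson-<ᵇ : ∀ {n} c → c ≤ n → ∑[ j < n ] iverson (toℕ j <ᵇ c) ≡ c
∑-iverson-<ᵇ {n}     zero    _         = sum-replicate-zero n
∑-iverson-<ᵇ {suc n} (suc c) (s≤s c≤n) = cong suc (∑-iverson-<ᵇ {n} c c≤n)

∑-iverson-∧ : ∀ {n} b (p : Fin n → Bool) →
              ∑[ i < n ] iverson (b ∧ p i) ≡ iverson b * ∑[ i < n ] iverson (p i)
∑-iverson-∧ {n} true  p = sym (+-identityʳ _)
∑-iverson-∧ {n} false p = sum-replicate-zero n

length-filterᵇ-tabulate : ∀ {A : Set} (p : A → Bool) {n} (f : Fin n → A) →
                          length (filterᵇ p (tabulate f)) ≡ ∑[ i < n ] iverson (p (f i))
length-filterᵇ-tabulate p {zero}  f = refl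
length-filterᵇ-tabulate p {suc n} f with p (f zero)
... | true  = cong suc (length-filterᵇ-tabulate p (f ∘ suc))
... | false = length-filterᵇ-tabulate p (f ∘ suc)

length-filterᵇ-cartesianProduct :
  ∀ {A B : Set} (p : A × B → Bool) {m n} (f : Fin m → A) (g : Fin n → B) →
  length (filterᵇ p (cartesianProduct (tabulate f) (tabulate g))) ≡
  ∑[ i < m ] ∑[ j < n ] iverson (p (f i , g j))
length-filterᵇ-cartesianProduct p {zero}  f g = refl
length-filterᵇ-cartesianProduct p {suc m} f g = begin
  length (filterᵇ p (map (f zero ,_) (tabulate g) ++ rest))
    ≡⟨ cong length (filter-++ _ (map (f zero ,_) (tabulate g)) rest) ⟩
  length (filterᵇ p (map (f zero ,_) (tabulate g)) ++ filterᵇ p rest)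
    ≡⟨ length-++ (filterᵇ p (map (f zero ,_) (tabulate g))) ⟩
  length (filterᵇ p (map (f zero ,_) (tabulate g))) + length (filterᵇ p rest)
    ≡⟨ cong₂ _+_ (trans (cong (length ∘ filterᵇ p) (map-tabulate g (f zero ,_)))
                        (length-filterᵇ-tabulate p (λ j → f zero , g j)))
                 (length-filterᵇ-cartesianProduct p (f ∘ suc) g) ⟩
  ∑[ j < _ ] iverson (p (f zero , g j)) + ∑[ i < m ] ∑[ j < _ ] iverson (p (f (suc i) , g j)) ∎
  where
  open ≡-Reasoning
  rest = cartesianProduct (tabulate (f ∘ suc)) (tabulate g)

≟-comm : ∀ {A : Set} (_≟_ : DecidableEquality A) x y → does (x ≟ y) ≡ does (y ≟ x)
≟-comm _≟_ x y = does-⇔ (mk⇔ sym sym) (x ≟ y) (y ≟ x)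

iverson≤1 : ∀ b → iverson b ≤ 1
iverson≤1 true  = ℕ.≤-refl
iverson≤1 false = z≤n

iverson-T : ∀ {b} → T b → iverson b ≡ 1
iverson-T {true} _ = refl

iverson-∨ : ∀ x y → (x ≡ true → y ≡ true → ⊥) → iverson (x ∨ y) ≡ iverson x + iverson y
iverson-∨ true  true  disjoint = ⊥-elim (disjoint refl refl)
iverson-∨ true  false _        = refl
iverson-∨ false y     _        = refl

odd-cycle : ∀ {x y z} → x ≡ not y → y ≡ not z → z ≡ not x → ⊥
odd-cycle {z = true}  refl refl ()
odd-cycle {z = false} refl refl ()

∧-true : ∀ {x y} → x ∧ y ≡ true → x ≡ true × y ≡ true
∧-true {true} {true} _ = refl , refl

witness : ∀ {A : Set} (d : Dec A) → does d ≡ true → A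
witness (yes a) _ = a

module Counting (G : FiniteGroup) where
  open FiniteGroup G
  group : Group _ _
  group = record { isGroup = isGroup }

  open GroupProperties group public
    using (⁻¹-involutive; ⁻¹-injective; ε⁻¹≈ε; //-rightDividesˡ; //-rightDividesʳ; x∙y⁻¹≈ε⇒x≈y)

  infix 4 _≟_
  _≟_ : DecidableEquality Carrier
  _≟_ = via-injection (↔⇒↣ enum) Fin._≟_

  ｛_｝ : Carrier → Carrier → Bool
  ｛ x ｝ t = does (t ≟ x)

  ∈｛｝ : ∀ {x t} → ｛ x ｝ t ≡ true → t ≡ x
  ∈｛｝ {x} {t} = witness (t ≟ x)

  ∅ : Carrier → Bool
  ∅ _ = false

  ∣_∣ : (Carrier → Bool) → ℕ
  ∣ S ∣ = ∑[ a < order ] iverson (S (Inverse.from enum a))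

  rightTranslation : Carrier → Carrier ↔ Carrier
  rightTranslation g = mk↔ₛ′ (_∙ g) (_∙ g ⁻¹) (//-rightDividesˡ g) (//-rightDividesʳ g)

  inversion : Carrier ↔ Carrier
  inversion = mk↔ₛ′ _⁻¹ _⁻¹ ⁻¹-involutive ⁻¹-involutive

  ∣∘∣ : (φ : Carrier ↔ Carrier) (S : Carrier → Bool) → ∣ S ∘ Inverse.to φ ∣ ≡ ∣ S ∣
  ∣∘∣ φ S = sym (trans (sum-permute (iverson ∘ S ∘ Inverse.from enum) (enum ↔-∘ (φ ↔-∘ ↔-sym enum)))
                       (sum-cong-≗ (cong (iverson ∘ S) ∘ from-to ∘ Inverse.to φ ∘ Inverse.from enum)))
    where from-to = Inverse.strictlyInverseʳ enum

  ∣∣-∧ : ∀ b S → ∣ (λ t → b ∧ S t) ∣ ≡ iverson b * ∣ S ∣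
  ∣∣-∧ b S = ∑-iverson-∧ b (S ∘ Inverse.from enum)

  ∣∅∣ : ∣ ∅ ∣ ≡ 0
  ∣∅∣ = sum-replicate-zero order

  ∑∣∅∣ : ∀ n → ∑[ i < n ] ∣ ∅ ∣ ≡ 0
  ∑∣∅∣ n = trans (sum-cong-≗ {n} (λ _ → ∣∅∣)) (sum-replicate-zero n)

  ∣｛｝∣ : ∀ x → ∣ ｛ x ｝ ∣ ≡ 1
  ∣｛｝∣ x = trans (sum-cong-≗ indicator) (∑-select (Inverse.to enum x) (λ _ → 1))
    where
    indicator : ∀ a → iverson (｛ x ｝ (Inverse.from enum a)) ≡ iverson (does (a Fin.≟ Inverse.to enum x)) * 1
    indicator a = trans (cong (λ b → iverson (does (b Fin.≟ Inverse.to enum x))) (Inverse.strictlyInverseˡ enum a))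
                        (sym (*-identityʳ _))

  ｛ε｝∘⁻¹ : ∀ t → ｛ ε ｝ (t ⁻¹) ≡ ｛ ε ｝ t
  ｛ε｝∘⁻¹ t = does-⇔ (mk⇔ (λ e → ⁻¹-injective (trans e (sym ε⁻¹≈ε))) (λ e → trans (cong _⁻¹ e) ε⁻¹≈ε))
                     (t ⁻¹ ≟ ε) (t ≟ ε)

  subset-of-size : ∀ c → c ≤ order → ∃[ S ] ∣ S ∣ ≡ c
  subset-of-size c c≤order = (λ t → toℕ (Inverse.to enum t) <ᵇ c) ,
    trans (sum-cong-≗ (λ a → cong (λ b → iverson (toℕ b <ᵇ c)) (Inverse.strictlyInverseˡ enum a)))
          (∑-iverson-<ᵇ c c≤order)

  valency≡∑∣T∣ : ∀ {m} (T : Subsets G m) g i → valency G T (g , i) ≡ ∑[ j < m ] ∣ T i j ∣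
  valency≡∑∣T∣ {m} T g i = begin
    length (filterᵇ (Adj G T (g , i)) (cartesianProduct elements (allFin m)))
      ≡⟨ cong (λ xs → length (filterᵇ (Adj G T (g , i)) (cartesianProduct xs (allFin m))))
              (map-tabulate (λ a → a) (Inverse.from enum)) ⟩
    length (filterᵇ (Adj G T (g , i)) (cartesianProduct (tabulate (Inverse.from enum)) (allFin m)))
      ≡⟨ length-filterᵇ-cartesianProduct (Adj G T (g , i)) (Inverse.from enum) (λ j → j) ⟩
    ∑[ a < order ] ∑[ j < m ] iverson (T i j (Inverse.from enum a ∙ g ⁻¹))
      ≡⟨ ∑-comm (λ a j → iverson (T i j (Inverse.from enum a ∙ g ⁻¹))) ⟩
    ∑[ j < m ] ∣ T i j ∘ Inverse.to (rightTranslation (g ⁻¹)) ∣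
      ≡⟨ sum-cong-≗ (λ j → ∣∘∣ (rightTranslation (g ⁻¹)) (T i j)) ⟩
    ∑[ j < m ] ∣ T i j ∣ ∎
    where open ≡-Reasoning

↔-injective : ∀ {A B : Set} (σ : A ↔ B) {x y} → Inverse.to σ x ≡ Inverse.to σ y → x ≡ y
↔-injective σ = Injection.injective (↔⇒↣ σ)

module CayleyAutomorphisms (G : FiniteGroup) where
  open FiniteGroup G
  open IsGroup isGroup using (inverseʳ)
  open Counting G using (//-rightDividesˡ; x∙y⁻¹≈ε⇒x≈y)

  automorphism-sym : ∀ {m} {T : Subsets G m} {σ} → IsAutomorphism G T σ → IsAutomorphism G T (↔-sym σ)
  automorphism-sym {T = T} {σ} isA v w =
    trans (sym (isA (Inverse.from σ v) (Inverse.from σ w)))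
          (cong₂ (Adj G T) (Inverse.strictlyInverseˡ σ v) (Inverse.strictlyInverseˡ σ w))

  triangle-transport : ∀ {m n} {T : Subsets G m} {T′ : Subsets G n} (φ : Vertex G m → Vertex G n) →
    (∀ {v w} → φ v ≡ φ w → v ≡ w) → (∀ v w → Adj G T′ (φ v) (φ w) ≡ Adj G T v w) →
    ∀ {v} → HasTriangleThrough G T v → HasTriangleThrough G T′ (φ v)
  triangle-transport φ φ-injective φ-Adj {v} (u , w , v≢u , u≢w , w≢v , vu , uw , wv) =
    φ u , φ w , v≢u ∘ φ-injective , u≢w ∘ φ-injective , w≢v ∘ φ-injective ,
    trans (φ-Adj v u) vu , trans (φ-Adj u w) uw , trans (φ-Adj w v) wv

  Pinned : ∀ {m} → (Vertex G m ↔ Vertex G m) → Carrier → Fin m → Set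
  Pinned σ g j = ∀ y → Inverse.to σ (y , j) ≡ rightMul G g (y , j)

  -- σ (x , q) is a neighbour of σ (x , p) = (x ∙ g , p); injectivity of σ rules out the pinned
  -- parts, leaving only (x ∙ g , q).
  pinned-step : ∀ {m} {T : Subsets G m} {σ g p q} → IsAutomorphism G T σ →
    Pinned σ g p → T p q ε ≡ true →
    (∀ j t → T p j t ≡ true → Pinned σ g j ⊎ (j ≡ q × t ≡ ε)) → Pinned σ g q
  pinned-step {T = T} {σ} {g} {p} {q} isA p-pinned pq p-neighbours x with Inverse.to σ (x , q) in σxq
  ... | y , j = [ via-pinned , via-matching ]′ (p-neighbours j _ edge)
    where
    open ≡-Reasoning
    edge : T p j (y ∙ (x ∙ g) ⁻¹) ≡ true
    edge = begin
      Adj G T (x ∙ g , p) (y , j)                           ≡⟨ cong₂ (Adj G T) (sym (p-pinned x)) (sym σxq) ⟩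
      Adj G T (Inverse.to σ (x , p)) (Inverse.to σ (x , q)) ≡⟨ isA (x , p) (x , q) ⟩
      T p q (x ∙ x ⁻¹)                                      ≡⟨ cong (T p q) (inverseʳ x) ⟩
      T p q ε                                               ≡⟨ pq ⟩
      true                                                  ∎
    via-pinned : Pinned σ g j → (y , j) ≡ (x ∙ g , q)
    via-pinned j-pinned = trans (cong (_, j) (sym (//-rightDividesˡ g y))) (cong (rightMul G g) preimage)
      where
      preimage : (y ∙ g ⁻¹ , j) ≡ (x , q)
      preimage = ↔-injective σ (trans (j-pinned (y ∙ g ⁻¹)) (trans (cong (_, j) (//-rightDividesˡ g y)) (sym σxq)))
    via-matching : j ≡ q × y ∙ (x ∙ g) ⁻¹ ≡ ε → (y , j) ≡ (x ∙ g , q)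
    via-matching (refl , e) = cong (_, q) (x∙y⁻¹≈ε⇒x≈y y (x ∙ g) e)

  module Restriction {n m} {T : Subsets G n} {T′ : Subsets G m} (f : Fin n → Fin m)
    (f-injective : ∀ {a b} → f a ≡ f b → a ≡ b) (T′∘f≡T : ∀ a b t → T′ (f a) (f b) t ≡ T a b t) where

    ι : Vertex G n → Vertex G m
    ι (y , a) = y , f a

    ι-injective : ∀ {v w} → ι v ≡ ι w → v ≡ w
    ι-injective e = cong₂ _,_ (cong proj₁ e) (f-injective (cong proj₂ e))

    ι-Adj : ∀ v w → Adj G T′ (ι v) (ι w) ≡ Adj G T v w
    ι-Adj (y , a) (z , b) = T′∘f≡T a b (z ∙ y ⁻¹)

    InImage : Vertex G m → Set
    InImage (_ , j) = ∃[ a ] f a ≡ j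

    restrict : (φ : Vertex G m → Vertex G m) → (∀ v → InImage (φ (ι v))) → Vertex G n → Vertex G n
    restrict φ image v = proj₁ (φ (ι v)) , proj₁ (image v)

    ι-restrict : ∀ φ image v → ι (restrict φ image v) ≡ φ (ι v)
    ι-restrict φ image v = cong (proj₁ (φ (ι v)) ,_) (proj₂ (image v))

    -- The image of ι is recognised by triangles, so every automorphism preserves it.
    restriction-pinned : AutIsRG G T → (∀ v → HasTriangleThrough G T v) →
      (∀ v → HasTriangleThrough G T′ v → InImage v) →
      ∀ σ → IsAutomorphism G T′ σ → ∃[ g ] ∀ a → Pinned σ g (f a)
    restriction-pinned aut triangles onTriangle⇒InImage σ isA =
      g , λ a y → trans (sym (ι-restrict to image (y , a))) (cong ι (restrict-σ≗rightMul (y , a)))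
      where
      image-of : ∀ τ → IsAutomorphism G T′ τ → ∀ v → InImage (Inverse.to τ (ι v))
      image-of τ isAτ v = onTriangle⇒InImage _
        (triangle-transport {T = T′} {T′ = T′} (Inverse.to τ) (↔-injective τ) isAτ
          (triangle-transport {T = T} {T′ = T′} ι ι-injective ι-Adj (triangles v)))
      to = Inverse.to σ
      from = Inverse.from σ
      image = image-of σ isA
      image⁻¹ = image-of (↔-sym σ) (automorphism-sym {T = T′} {σ = σ} isA)
      σ↾ : Vertex G n ↔ Vertex G n
      σ↾ = mk↔ₛ′ (restrict to image) (restrict from image⁻¹)
        (λ v → ι-injective (trans (ι-restrict to image _)
                           (trans (cong to (ι-restrict from image⁻¹ v)) (Inverse.strictlyInverseˡ σ (ι v)))))
        (λ v → ι-injective (trans (ι-restrict from image⁻¹ _)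
                           (trans (cong from (ι-restrict to image v)) (Inverse.strictlyInverseʳ σ (ι v)))))
      σ↾-automorphism : IsAutomorphism G T σ↾
      σ↾-automorphism v w = begin
        Adj G T (restrict to image v) (restrict to image w)           ≡⟨ sym (ι-Adj _ _) ⟩
        Adj G T′ (ι (restrict to image v)) (ι (restrict to image w)) ≡⟨ cong₂ (Adj G T′) (ι-restrict to image v) (ι-restrict to image w) ⟩
        Adj G T′ (to (ι v)) (to (ι w))                                ≡⟨ isA (ι v) (ι w) ⟩
        Adj G T′ (ι v) (ι w)                                          ≡⟨ ι-Adj v w ⟩
        Adj G T v w                                                   ∎
        where open ≡-Reasoning
      g = proj₁ (aut σ↾ σ↾-automorphism)
      restrict-σ≗rightMul = proj₂ (aut σ↾ σ↾-automorphism)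

module Path (s : ℕ) where

  next : Fin s → Fin s → Bool
  next i j = does (suc (toℕ i) ℕ.≟ toℕ j)

  adjacent : Fin s → Fin s → Bool
  adjacent i j = next i j ∨ next j i

  adjacent-irrefl : ∀ i → adjacent i i ≡ false
  adjacent-irrefl i rewrite dec-false (suc (toℕ i) ℕ.≟ toℕ i) 1+n≢n = refl

  next-asymmetric : ∀ i j → next i j ≡ true → next j i ≡ true → ⊥
  next-asymmetric i j ij ji =
    ℕ.m≢1+n+m (toℕ i) (sym (trans (cong suc (witness (suc (toℕ i) ℕ.≟ toℕ j) ij)) (witness (suc (toℕ j) ℕ.≟ toℕ i) ji)))

  adjacent⇒ : ∀ i j → adjacent i j ≡ true → suc (toℕ i) ≡ toℕ j ⊎ suc (toℕ j) ≡ toℕ i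
  adjacent⇒ i j ij with next i j in i→j
  ... | true  = inj₁ (witness (suc (toℕ i) ℕ.≟ toℕ j) i→j)
  ... | false = inj₂ (witness (suc (toℕ j) ℕ.≟ toℕ i) ij)

  colour : Bool → ℕ → Bool
  colour b zero    = b
  colour b (suc n) = not (colour b n)

  colour-not : ∀ b n → colour (not b) n ≡ not (colour b n)
  colour-not b zero    = refl
  colour-not b (suc n) = cong not (colour-not b n)

  colour-adjacent : ∀ b i j → adjacent i j ≡ true → colour b (toℕ j) ≡ not (colour b (toℕ i))
  colour-adjacent b i j ij with adjacent⇒ i j ij
  ... | inj₁ i→j = cong (colour b) (sym i→j)
  ... | inj₂ j→i = trans (sym (not-involutive _)) (cong (not ∘ colour b) j→i)

  hasNext : Fin s → Bool
  hasNext i = suc (toℕ i) <ᵇ s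

  predecessors : Fin s → ℕ
  predecessors zero    = 0
  predecessors (suc _) = 1

  ∑-adjacent : ∀ i → ∑[ j < s ] iverson (adjacent i j) ≡ iverson (hasNext i) + predecessors i
  ∑-adjacent i = begin
    ∑[ j < s ] iverson (adjacent i j)
      ≡⟨ sum-cong-≗ (λ j → iverson-∨ (next i j) (next j i) (next-asymmetric i j)) ⟩
    ∑[ j < s ] (iverson (next i j) + iverson (next j i))
      ≡⟨ ∑-distrib-+ (λ j → iverson (next i j)) (λ j → iverson (next j i)) ⟩
    ∑[ j < s ] iverson (next i j) + ∑[ j < s ] iverson (next j i)
      ≡⟨ cong₂ _+_ (trans (sum-cong-≗ {s} (λ j → cong iverson (≟-comm ℕ._≟_ (suc (toℕ i)) (toℕ j))))
                          (∑-iverson-≡ᵇ {s} (suc (toℕ i))))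
                   (∑-next-to i) ⟩
    iverson (hasNext i) + predecessors i ∎
    where
    open ≡-Reasoning
    ∑-next-to : ∀ i → ∑[ j < s ] iverson (next j i) ≡ predecessors i
    ∑-next-to zero    = sum-replicate-zero s
    ∑-next-to (suc i) = trans (∑-iverson-≡ᵇ (toℕ i)) (iverson-T (<⇒<ᵇ (ℕ.m<n⇒m<1+n (Fin.toℕ<n i))))

-- S a is the part G_(a+1) of Σ, and R b i is the i-th part of rail b.
module TwoRails (G : FiniteGroup) (Tm : Subsets G 3) (Tm-admissible : Admissible G Tm)
                (r : ℕ) (C : Fin (suc r) → FiniteGroup.Carrier G → Bool) where
  open FiniteGroup G
  open Counting G
  open CayleyAutomorphisms G
  open Admissible Tm-admissible
  open Path (suc r)

  s : ℕ
  s = suc r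

  m : ℕ
  m = 3 + (s + s)

  data Part : Set where
    S : Fin 3 → Part
    R : Bool → Fin s → Part

  enc : Part → Fin m
  enc (S a)       = a ↑ˡ (s + s)
  enc (R false i) = 3 ↑ʳ (i ↑ˡ s)
  enc (R true  i) = 3 ↑ʳ (s ↑ʳ i)

  dec : Fin m → Part
  dec j = [ S , [ R false , R true ]′ ∘ splitAt s ]′ (splitAt 3 j)

  dec-enc : ∀ P → dec (enc P) ≡ P
  dec-enc (S a)       rewrite Fin.splitAt-↑ˡ 3 a (s + s) = refl
  dec-enc (R false i) rewrite Fin.splitAt-↑ˡ s i s = refl
  dec-enc (R true  i) rewrite Fin.splitAt-↑ʳ s s i = refl

  enc-dec : ∀ j → enc (dec j) ≡ j
  enc-dec j with splitAt 3 j in e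
  ... | inj₁ a = Fin.splitAt⁻¹-↑ˡ e
  ... | inj₂ x with splitAt s x in e′
  ...   | inj₁ i = trans (cong (3 ↑ʳ_) (Fin.splitAt⁻¹-↑ˡ e′)) (Fin.splitAt⁻¹-↑ʳ e)
  ...   | inj₂ i = trans (cong (3 ↑ʳ_) (Fin.splitAt⁻¹-↑ʳ e′)) (Fin.splitAt⁻¹-↑ʳ e)

  S-injective : ∀ {a b} → S a ≡ S b → a ≡ b
  S-injective refl = refl

  enc-injective : ∀ {P Q} → enc P ≡ enc Q → P ≡ Q
  enc-injective {P} {Q} e = trans (sym (dec-enc P)) (trans (cong dec e) (dec-enc Q))

  attach : Fin 3 → Bool → Fin s → Carrier → Bool
  attach (suc zero)       false zero = ｛ ε ｝
  attach (suc (suc zero)) true  zero = ｛ ε ｝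
  attach _                _     _    = ∅

  along : Fin s → Fin s → Carrier → Bool
  along i j t = adjacent i j ∧ ｛ ε ｝ t

  rung : Fin s → Fin s → Carrier → Bool
  rung i j t = does (j Fin.≟ i) ∧ C j t

  Tp : Part → Part → Carrier → Bool
  Tp (S a)       (S b)       t = Tm a b t
  Tp (S a)       (R b i)     t = attach a b i t
  Tp (R b i)     (S a)       t = attach a b i (t ⁻¹)
  Tp (R false i) (R false j) t = along i j t
  Tp (R true  i) (R true  j) t = along i j t
  Tp (R false i) (R true  j) t = rung i j t
  Tp (R true  i) (R false j) t = rung j i (t ⁻¹)

  T′ : Subsets G m
  T′ j j′ = Tp (dec j) (dec j′)

  Tp-irrefl : ∀ P t → Tp P P t ≡ false
  Tp-irrefl (S a)       t = diag-empty a t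
  Tp-irrefl (R false i) t = cong (_∧ ｛ ε ｝ t) (adjacent-irrefl i)
  Tp-irrefl (R true  i) t = cong (_∧ ｛ ε ｝ t) (adjacent-irrefl i)

  Tp-transpose : ∀ P Q t → Tp Q P t ≡ Tp P Q (t ⁻¹)
  Tp-transpose (S a)       (S b)       t = inv-sym a b t
  Tp-transpose (S a)       (R b i)     t = refl
  Tp-transpose (R b i)     (S a)       t = cong (attach a b i) (sym (⁻¹-involutive t))
  Tp-transpose (R false i) (R false j) t = cong₂ _∧_ (∨-comm (next j i) (next i j)) (sym (｛ε｝∘⁻¹ t))
  Tp-transpose (R true  i) (R true  j) t = cong₂ _∧_ (∨-comm (next j i) (next i j)) (sym (｛ε｝∘⁻¹ t))
  Tp-transpose (R false i) (R true  j) t = refl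
  Tp-transpose (R true  i) (R false j) t = cong (rung j i) (sym (⁻¹-involutive t))

  T′-enc : ∀ P Q t → T′ (enc P) (enc Q) t ≡ Tp P Q t
  T′-enc P Q t = cong₂ (λ P′ Q′ → Tp P′ Q′ t) (dec-enc P) (dec-enc Q)

  T′-admissible : Admissible G T′
  T′-admissible = record
    { diag-empty = λ j → Tp-irrefl (dec j)
    ; inv-sym    = λ j j′ → Tp-transpose (dec j) (dec j′)
    }

  partDegree : Part → ℕ
  partDegree P = ∑[ a < 3 ] ∣ Tp P (S a) ∣ + (∑[ i < s ] ∣ Tp P (R false i) ∣ + ∑[ i < s ] ∣ Tp P (R true i) ∣)

  valency-T′ : ∀ g j → valency G T′ (g , j) ≡ partDegree (dec j)
  valency-T′ g j = begin
    valency G T′ (g , j)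
      ≡⟨ valency≡∑∣T∣ T′ g j ⟩
    ∑[ j′ < m ] ∣ Tp P (dec j′) ∣
      ≡⟨ ∑-split {3} {s + s} (λ j′ → ∣ Tp P (dec j′) ∣) ⟩
    ∑[ a < 3 ] ∣ Tp P (dec (enc (S a))) ∣ + ∑[ x < s + s ] ∣ Tp P (dec (3 ↑ʳ x)) ∣
      ≡⟨ cong₂ _+_ (sum-cong-≗ (size-dec-enc ∘ S)) (∑-split {s} {s} (λ x → ∣ Tp P (dec (3 ↑ʳ x)) ∣)) ⟩
    ∑[ a < 3 ] ∣ Tp P (S a) ∣ + (∑[ i < s ] ∣ Tp P (dec (enc (R false i))) ∣ + ∑[ i < s ] ∣ Tp P (dec (enc (R true i))) ∣)
      ≡⟨ cong (∑[ a < 3 ] ∣ Tp P (S a) ∣ +_)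
              (cong₂ _+_ (sum-cong-≗ (size-dec-enc ∘ R false)) (sum-cong-≗ (size-dec-enc ∘ R true))) ⟩
    partDegree P ∎
    where
    open ≡-Reasoning
    P = dec j
    size-dec-enc : ∀ Q → ∣ Tp P (dec (enc Q)) ∣ ≡ ∣ Tp P Q ∣
    size-dec-enc Q = cong (λ Q′ → ∣ Tp P Q′ ∣) (dec-enc Q)

  attachments : Fin s → ℕ
  attachments zero    = 1
  attachments (suc _) = 0

  attachedRails : Fin 3 → ℕ
  attachedRails zero    = 0
  attachedRails (suc _) = 1

  ∑-attach-rails : ∀ a → ∑[ i < s ] ∣ attach a false i ∣ + ∑[ i < s ] ∣ attach a true i ∣ ≡ attachedRails a
  ∑-attach-rails zero                = cong₂ _+_ (∑∣∅∣ s) (∑∣∅∣ s)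
  ∑-attach-rails (suc zero)          = cong₂ _+_ (cong₂ _+_ (∣｛｝∣ ε) (∑∣∅∣ r)) (∑∣∅∣ s)
  ∑-attach-rails (suc (suc zero))    = cong₂ _+_ (∑∣∅∣ s) (cong₂ _+_ (∣｛｝∣ ε) (∑∣∅∣ r))

  ∑-attach-parts : ∀ b i → ∑[ a < 3 ] ∣ Tp (R b i) (S a) ∣ ≡ attachments i
  ∑-attach-parts b i = trans (sum-cong-≗ (λ a → ∣∘∣ inversion (attach a b i))) (count b i)
    where
    count : ∀ b i → ∑[ a < 3 ] ∣ attach a b i ∣ ≡ attachments i
    count false zero    = cong₂ _+_ ∣∅∣ (cong₂ _+_ (∣｛｝∣ ε) (cong (_+ 0) ∣∅∣))
    count true  zero    = cong₂ _+_ ∣∅∣ (cong₂ _+_ ∣∅∣ (cong (_+ 0) (∣｛｝∣ ε)))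
    count false (suc i) = ∑∣∅∣ 3
    count true  (suc i) = ∑∣∅∣ 3

  ∣along∣ : ∀ i j → ∣ along i j ∣ ≡ iverson (adjacent i j)
  ∣along∣ i j = trans (∣∣-∧ (adjacent i j) ｛ ε ｝)
                      (trans (cong (iverson (adjacent i j) *_) (∣｛｝∣ ε)) (*-identityʳ _))

  ∑-along : ∀ i → ∑[ j < s ] ∣ along i j ∣ ≡ iverson (hasNext i) + predecessors i
  ∑-along i = trans (sum-cong-≗ (∣along∣ i)) (∑-adjacent i)

  ∑-rung : ∀ i → ∑[ j < s ] ∣ rung i j ∣ ≡ ∣ C i ∣
  ∑-rung i = trans (sum-cong-≗ (λ j → ∣∣-∧ (does (j Fin.≟ i)) (C j))) (∑-select i (λ j → ∣ C j ∣))

  ∑-rung⁻¹ : ∀ i → ∑[ j < s ] ∣ Tp (R true i) (R false j) ∣ ≡ ∣ C i ∣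
  ∑-rung⁻¹ i = trans (sum-cong-≗ (λ j → trans (∣∘∣ inversion (rung j i))
                                       (trans (∣∣-∧ (does (i Fin.≟ j)) (C i))
                                              (cong (λ b → iverson b * ∣ C i ∣) (≟-comm Fin._≟_ i j)))))
                     (∑-select i (λ _ → ∣ C i ∣))

  module Regularity (k : ℕ)
    (valency₀ : ∀ g → valency G Tm (g , zero) ≡ suc k)
    (valency₁₂ : ∀ g → valency G Tm (g , suc zero) ≡ k × valency G Tm (g , suc (suc zero)) ≡ k)
    (∣C∣ : ∀ i → iverson (hasNext i) + ∣ C i ∣ ≡ k) where

    Σ-degree : ∀ a → ∑[ b < 3 ] ∣ Tm a b ∣ + attachedRails a ≡ suc k
    Σ-degree a = trans (cong (_+ attachedRails a) (sym (valency≡∑∣T∣ Tm ε a))) (degree a)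
      where
      degree : ∀ a → valency G Tm (ε , a) + attachedRails a ≡ suc k
      degree zero             = trans (+-identityʳ _) (valency₀ ε)
      degree (suc zero)       = trans (ℕ.+-comm _ 1) (cong suc (proj₁ (valency₁₂ ε)))
      degree (suc (suc zero)) = trans (ℕ.+-comm _ 1) (cong suc (proj₂ (valency₁₂ ε)))

    rail-degree : ∀ i → attachments i + ((iverson (hasNext i) + predecessors i) + ∣ C i ∣) ≡ suc k
    rail-degree i = trans (regroup (attachments i) (iverson (hasNext i)) (predecessors i) ∣ C i ∣)
                          (cong₂ _+_ (attachments+predecessors i) (∣C∣ i))
      where
      regroup : ∀ a h p c → a + ((h + p) + c) ≡ (a + p) + (h + c)
      regroup = solve 4 (λ a h p c → a :+ ((h :+ p) :+ c) := (a :+ p) :+ (h :+ c)) refl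
      attachments+predecessors : ∀ i → attachments i + predecessors i ≡ 1
      attachments+predecessors zero    = refl
      attachments+predecessors (suc _) = refl

    partDegree≡ : ∀ P → partDegree P ≡ suc k
    partDegree≡ (S a)       = trans (cong (∑[ b < 3 ] ∣ Tm a b ∣ +_) (∑-attach-rails a)) (Σ-degree a)
    partDegree≡ (R false i) =
      trans (cong₂ _+_ (∑-attach-parts false i) (cong₂ _+_ (∑-along i) (∑-rung i))) (rail-degree i)
    partDegree≡ (R true  i) =
      trans (cong₂ _+_ (∑-attach-parts true i) (trans (cong₂ _+_ (∑-rung⁻¹ i) (∑-along i)) (ℕ.+-comm ∣ C i ∣ _)))
            (rail-degree i)

    T′-regular : Regular G T′
    T′-regular = suc k , λ (g , j) → trans (valency-T′ g j) (partDegree≡ (dec j))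

  data Hang : Fin 3 → Bool → Fin s → Set where
    hang₁ : Hang (suc zero) false zero
    hang₂ : Hang (suc (suc zero)) true zero

  attach-inv : ∀ a b i {t} → attach a b i t ≡ true → Hang a b i × t ≡ ε
  attach-inv (suc zero)       false zero    e = hang₁ , ∈｛｝ e
  attach-inv (suc (suc zero)) true  zero    e = hang₂ , ∈｛｝ e
  attach-inv zero             _     _       ()
  attach-inv (suc zero)       false (suc _) ()
  attach-inv (suc zero)       true  _       ()
  attach-inv (suc (suc zero)) false _       ()
  attach-inv (suc (suc zero)) true  (suc _) ()

  hang-unique : ∀ {a a′ b i} → Hang a b i → Hang a′ b i → a ≡ a′
  hang-unique hang₁ hang₁ = refl
  hang-unique hang₂ hang₂ = refl

  rail-neighbour : ∀ b b′ i j {t} → Tp (R b i) (R b′ j) t ≡ true →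
                   (b′ ≡ b × adjacent i j ≡ true × t ≡ ε) ⊎ (b′ ≡ not b × j ≡ i)
  rail-neighbour false false i j e = inj₁ (refl , proj₁ (∧-true e) , ∈｛｝ (proj₂ (∧-true e)))
  rail-neighbour true  true  i j e = inj₁ (refl , proj₁ (∧-true e) , ∈｛｝ (proj₂ (∧-true e)))
  rail-neighbour false true  i j e = inj₂ (refl , witness (j Fin.≟ i) (proj₁ (∧-true e)))
  rail-neighbour true  false i j e = inj₂ (refl , sym (witness (i Fin.≟ j) (proj₁ (∧-true e))))

  data PartAdj : Part → Part → Set where
    inner : ∀ {a a′} → a ≢ a′ → PartAdj (S a) (S a′)
    hang→ : ∀ {a b i} → Hang a b i → PartAdj (S a) (R b i)
    hang← : ∀ {a b i} → Hang a b i → PartAdj (R b i) (S a)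
    flip  : ∀ {b i b′ j} → colour b′ (toℕ j) ≡ not (colour b (toℕ i)) → PartAdj (R b i) (R b′ j)

  partAdj : ∀ P Q {t} → Tp P Q t ≡ true → PartAdj P Q
  partAdj (S a)   (S a′)   e = inner λ { refl → contradiction (trans (sym e) (diag-empty a _)) λ () }
  partAdj (S a)   (R b i)  e = hang→ (proj₁ (attach-inv a b i e))
  partAdj (R b i) (S a)    e = hang← (proj₁ (attach-inv a b i e))
  partAdj (R b i) (R b′ j) e with rail-neighbour b b′ i j e
  ... | inj₁ (refl , ij , _) = flip (colour-adjacent b i j ij)
  ... | inj₂ (refl , refl)   = flip (colour-not b (toℕ i))

  no-triangle-at-rail : ∀ {b i Q P} → PartAdj (R b i) Q → PartAdj Q P → PartAdj P (R b i) → ⊥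
  no-triangle-at-rail (hang← h)     (inner a≢a′)  (hang→ h′)    = a≢a′ (hang-unique h h′)
  no-triangle-at-rail (hang← hang₁) (hang→ hang₁) (flip e)      = not-¬ refl e
  no-triangle-at-rail (hang← hang₂) (hang→ hang₂) (flip e)      = not-¬ refl e
  no-triangle-at-rail (flip e)      (hang← hang₁) (hang→ hang₁) = not-¬ refl e
  no-triangle-at-rail (flip e)      (hang← hang₂) (hang→ hang₂) = not-¬ refl e
  no-triangle-at-rail (flip e₁)     (flip e₂)     (flip e₃)     = odd-cycle e₃ e₂ e₁

  onTriangle⇒Σ : ∀ v → HasTriangleThrough G T′ v → ∃[ a ] enc (S a) ≡ proj₂ v
  onTriangle⇒Σ (x , j) ((y , j₁) , (z , j₂) , _ , _ , _ , e₁ , e₂ , e₃) with dec j in dj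
  ... | S a   = a , trans (cong enc (sym dj)) (enc-dec j)
  ... | R b i = ⊥-elim (no-triangle-at-rail (partAdj (R b i) (dec j₁) e₁) (partAdj (dec j₁) (dec j₂) e₂)
                                            (partAdj (dec j₂) (R b i) e₃))

  hub : Bool → Fin 3
  hub false = suc zero
  hub true  = suc (suc zero)

  hub-edge : ∀ b → Tp (S (hub b)) (R b zero) ε ≡ true
  hub-edge false = dec-true (ε ≟ ε) refl
  hub-edge true  = dec-true (ε ≟ ε) refl

  hub-hang : ∀ b {b′ i} → Hang (hub b) b′ i → R b′ i ≡ R b zero
  hub-hang false hang₁ = refl
  hub-hang true  hang₂ = refl

  along-edge : ∀ b {i j} → suc (toℕ i) ≡ toℕ j → Tp (R b i) (R b j) ε ≡ true
  along-edge false {i} {j} i→j rewrite dec-true (suc (toℕ i) ℕ.≟ toℕ j) i→j = dec-true (ε ≟ ε) refl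
  along-edge true  {i} {j} i→j rewrite dec-true (suc (toℕ i) ℕ.≟ toℕ j) i→j = dec-true (ε ≟ ε) refl

  module Pinning {σ : Vertex G m ↔ Vertex G m} (isA : IsAutomorphism G T′ σ) (g : Carrier)
                 (Σ-pinned : ∀ a → Pinned σ g (enc (S a))) where

    PinnedPart : Part → Set
    PinnedPart P = Pinned σ g (enc P)

    step : ∀ {P Q} → PinnedPart P → Tp P Q ε ≡ true →
           (∀ Q′ t → Tp P Q′ t ≡ true → PinnedPart Q′ ⊎ (Q′ ≡ Q × t ≡ ε)) → PinnedPart Q
    step {P} {Q} P-pinned PQ P-neighbours =
      pinned-step {T = T′} {σ} isA P-pinned (trans (T′-enc P Q ε) PQ) neighbours
      where
      neighbours : ∀ j t → T′ (enc P) j t ≡ true → Pinned σ g j ⊎ (j ≡ enc Q × t ≡ ε)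
      neighbours j t e with P-neighbours (dec j) t (subst (λ P′ → Tp P′ (dec j) t ≡ true) (dec-enc P) e)
      ... | inj₁ pinned       = inj₁ (subst (Pinned σ g) (enc-dec j) pinned)
      ... | inj₂ (dj≡Q , t≡ε) = inj₂ (trans (sym (enc-dec j)) (cong enc dj≡Q) , t≡ε)

    rail-start : ∀ b → PinnedPart (R b zero)
    rail-start b = step {S (hub b)} (Σ-pinned (hub b)) (hub-edge b) hub-neighbours
      where
      hub-neighbours : ∀ Q t → Tp (S (hub b)) Q t ≡ true → PinnedPart Q ⊎ (Q ≡ R b zero × t ≡ ε)
      hub-neighbours (S a)    t e = inj₁ (Σ-pinned a)
      hub-neighbours (R b′ i) t e with attach-inv (hub b) b′ i e
      ... | hanging , t≡ε = inj₂ (hub-hang b hanging , t≡ε)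

    PinnedUpTo : Fin s → Set
    PinnedUpTo i = ∀ b j → toℕ j ≤ toℕ i → PinnedPart (R b j)

    pinned-up-to-zero : PinnedUpTo zero
    pinned-up-to-zero b zero _ = rail-start b

    rail-advance : ∀ i → PinnedUpTo (inject₁ i) → ∀ b → PinnedPart (R b (suc i))
    rail-advance i pinned-below b =
      step {R b p} (pinned-below b p ℕ.≤-refl) (along-edge b p→suc-i) p-neighbours
      where
      p = inject₁ i
      p→suc-i : suc (toℕ p) ≡ toℕ (suc i)
      p→suc-i = cong suc (Fin.toℕ-inject₁ i)
      p-neighbours : ∀ Q t → Tp (R b p) Q t ≡ true → PinnedPart Q ⊎ (Q ≡ R b (suc i) × t ≡ ε)
      p-neighbours (S a)    t e = inj₁ (Σ-pinned a)
      p-neighbours (R b′ j) t e with rail-neighbour b b′ p j e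
      ... | inj₂ (refl , refl) = inj₁ (pinned-below (not b) p ℕ.≤-refl)
      ... | inj₁ (refl , pj , t≡ε) with adjacent⇒ p j pj
      ...   | inj₁ p→j = inj₂ (cong (R b) (Fin.toℕ-injective (trans (sym p→j) p→suc-i)) , t≡ε)
      ...   | inj₂ j→p = inj₁ (pinned-below b j (ℕ.≤-trans (ℕ.n≤1+n (toℕ j)) (ℕ.≤-reflexive j→p)))

    pinned-up-to-suc : ∀ i → PinnedUpTo (inject₁ i) → PinnedUpTo (suc i)
    pinned-up-to-suc i pinned-below b j j≤suc-i with ℕ.m≤n⇒m<n∨m≡n j≤suc-i
    ... | inj₁ j<suc-i = pinned-below b j (ℕ.≤-trans (s≤s⁻¹ j<suc-i) (ℕ.≤-reflexive (sym (Fin.toℕ-inject₁ i))))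
    ... | inj₂ j≡suc-i = subst (PinnedPart ∘ R b) (sym (Fin.toℕ-injective j≡suc-i)) (rail-advance i pinned-below b)

    all-pinned : ∀ P → PinnedPart P
    all-pinned (S a)   = Σ-pinned a
    all-pinned (R b i) = <-weakInduction PinnedUpTo pinned-up-to-zero pinned-up-to-suc i b i ℕ.≤-refl

  T′-AutIsRG : AutIsRG G Tm → (∀ g i → HasTriangleThrough G Tm (g , i)) → AutIsRG G T′
  T′-AutIsRG aut triangles σ isA =
    g , λ (y , j) → subst (λ j′ → Inverse.to σ (y , j′) ≡ rightMul G g (y , j′)) (enc-dec j) (all-pinned (dec j) y)
    where
    open Restriction {T = Tm} {T′} (enc ∘ S) (S-injective ∘ enc-injective) (λ a b → T′-enc (S a) (S b))
    Σ-pinned = restriction-pinned aut (λ (y , a) → triangles y a) onTriangle⇒Σ σ isA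
    g = proj₁ Σ-pinned
    open Pinning {σ} isA g (proj₂ Σ-pinned)

odd⇒suc-double : ∀ m → Odd m → ∃[ h ] m ≡ suc (h + h)
odd⇒suc-double zero          odd = ⊥-elim (odd (2 ∣0))
odd⇒suc-double (suc zero)    _   = 0 , refl
odd⇒suc-double (suc (suc m)) odd with odd⇒suc-double m (odd ∘ ∣m∣n⇒∣m+n ∣-refl)
... | h , refl = suc h , cong (λ n → suc (suc n)) (sym (ℕ.+-suc h h))

odd-≥5⇒3+double : ∀ {m} → Odd m → 5 ≤ m → ∃[ r ] m ≡ 3 + (suc r + suc r)
odd-≥5⇒3+double {m} odd 5≤m with odd⇒suc-double m odd
... | zero , refl          = contradiction 5≤m λ { (s≤s ()) }
... | suc zero , refl      = contradiction 5≤m λ { (s≤s (s≤s (s≤s ()))) }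
... | suc (suc r) , refl   = r , cong (3 +_) (ℕ.+-suc r (suc r))

lemma2p2 : (G : FiniteGroup) (T : Subsets G 3) → IsPGSR G 3 T →
    (k : ℕ) → 2 ≤ k → k ≤ FiniteGroup.order G →
    (∀ g → valency G T (g , zero) ≡ suc k) →
    (∀ g → valency G T (g , suc zero) ≡ k × valency G T (g , suc (suc zero)) ≡ k) →
    (∀ g (i : Fin 3) → HasTriangleThrough G T (g , i)) →
    ∀ (m : ℕ) → Odd m → 5 ≤ m → HasHGR G m
lemma2p2 G T (admissible , aut) k 2≤k k≤order valency₀ valency₁₂ triangles m odd 5≤m
  with odd-≥5⇒3+double odd 5≤m
... | r , refl = s≤s (s≤s z≤n) , T′ , T′-admissible , T′-regular , T′-AutIsRG aut triangles
  where
  open Counting G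
  open Path (suc r)
  rung-set : ∀ i → ∃[ C ] ∣ C ∣ ≡ k ∸ iverson (hasNext i)
  rung-set i = subset-of-size (k ∸ iverson (hasNext i)) (ℕ.≤-trans (ℕ.m∸n≤m k (iverson (hasNext i))) k≤order)
  ∣rung-set∣ : ∀ i → iverson (hasNext i) + ∣ proj₁ (rung-set i) ∣ ≡ k
  ∣rung-set∣ i = trans (cong (iverson (hasNext i) +_) (proj₂ (rung-set i)))
                       (ℕ.m+[n∸m]≡n (ℕ.≤-trans (iverson≤1 (hasNext i)) (ℕ.≤-trans (ℕ.n≤1+n 1) 2≤k)))
  open TwoRails G T admissible r (proj₁ ∘ rung-set)
  open Regularity k valency₀ valency₁₂ ∣rung-set∣
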